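{- For every countable ordinal $\eta<\omega_1$ and every $l<\omega$, the language $L_{\le\eta+\omega+l}=\{x\in\mathrm{Tr}_{\{0,1\}}\mid x\text{ is well-founded and }\mathrm{rank}(x)\le\eta+\omega+l\}$ is not regular.
   Context: $\mathrm{Tr}_{\{0,1\}}$ is the set of maps $x\colon\{\mathtt{L},\mathtt{R}\}^*\to\{0,1\}$. $x$ is well-founded if no infinite branch contains infinitely many nodes labelled $1$; $\mathrm{rank}(x)$ is the least ordinal $\eta$ admitting a map $C$ from the $1$-labelled nodes to $\eta$ with $C(u)<C(v)$ whenever $u$ is a proper descendant of $v$. A tree language is regular if recognised by a nondeterministic parity tree automaton (equivalently MSO-definable). $\omega_1$ is the least uncountable ordinal. -}

module Defs where

open import Data.Nat using (ℕ; zero; suc; _≥_) renaming (_≤_ to _≤ℕ_)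
open import Data.Nat.Divisibility using (_∣_)
open import Data.Fin using (Fin)
open import Data.Bool using (Bool; true; false)
open import Data.List using (List; []; _∷_; _++_)
open import Data.Product using (Σ; ∃; _×_; _,_)
open import Relation.Binary.PropositionalEquality using (_≡_)
open import Relation.Nullary using (¬_)

-- Infinite binary trees with labels in {0,1}  (1 = true, 0 = false)

data Dir : Set where
  L R : Dir

-- A node is the path from the root, read from the root downwards.
Node : Set
Node = List Dir

Tree : Set
Tree = Node → Bool

_⊏_ : Node → Node → Set
u ⊏ v = Σ Node λ w → (w ≢[] ) × (u ≡ v ++ w)
  where
  _≢[] : Node → Set
  w ≢[] = ¬ (w ≡ [])

Branch : Set
Branch = ℕ → Dir

prefix : Branch → ℕ → Node
prefix b zero    = []
prefix b (suc n) = prefix b n ++ (b n ∷ [])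

InfinitelyOften : (ℕ → Set) → Set
InfinitelyOften P = ∀ n → Σ ℕ λ m → (m ≥ n) × P m

Eventually : (ℕ → Set) → Set
Eventually P = Σ ℕ λ n → ∀ m → m ≥ n → P m

WellFounded : Tree → Set
WellFounded x = ¬ (Σ Branch λ b → InfinitelyOften (λ m → x (prefix b m) ≡ true))

-- Countable ordinals as Brouwer trees

data Ord : Set where
  ozero : Ord
  osuc  : Ord → Ord
  olim  : (ℕ → Ord) → Ord

data _≤o_ : Ord → Ord → Set where
  ≤-zero     : ∀ {a} → ozero ≤o a
  ≤-trans    : ∀ {a b c} → a ≤o b → b ≤o c → a ≤o c
  ≤-suc-mono : ∀ {a b} → a ≤o b → osuc a ≤o osuc b
  ≤-cocone   : ∀ {a f} k → a ≤o f k → a ≤o olim f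
  ≤-limiting : ∀ {f a} → (∀ k → f k ≤o a) → olim f ≤o a

_<o_ : Ord → Ord → Set
a <o b = osuc a ≤o b

fin : ℕ → Ord
fin zero    = ozero
fin (suc n) = osuc (fin n)

ω : Ord
ω = olim fin

_+o_ : Ord → Ord → Ord
a +o ozero  = a
a +o osuc b = osuc (a +o b)
a +o olim f = olim (λ n → a +o f n)

-- rank(x) ≤ α  iff  there is C from 1-labelled nodes into α (ordinals < α)
-- with C(u) < C(v) whenever u is a proper descendant of v.
-- (rank(x) is the least η admitting such a map into η.)
RankLeq : Tree → Ord → Set
RankLeq x α =
  Σ ((u : Node) → x u ≡ true → Ord) λ C →
    (∀ u (p : x u ≡ true) → C u p <o α) ×
    (∀ u v (p : x u ≡ true) (q : x v ≡ true) → u ⊏ v → C u p <o C v q)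

record PTA : Set where
  field
    nStates  : ℕ
    initial  : Fin nStates
    -- transition relation Δ ⊆ Q × {0,1} × Q × Q (finite, given by its
    -- characteristic function): (q, a, q_L, q_R)
    δ        : Fin nStates → Bool → Fin nStates → Fin nStates → Bool
    priority : Fin nStates → ℕ

ParityAccepting : (ℕ → ℕ) → Set
ParityAccepting π =
  Σ ℕ λ p → (2 ∣ p) × InfinitelyOften (λ m → π m ≡ p)
                   × Eventually (λ m → π m ≤ℕ p)

Accepts : PTA → Tree → Set
Accepts A x =
  Σ (Node → Fin nStates) λ ρ →
    (ρ [] ≡ initial) ×
    (∀ w → δ (ρ w) (x w) (ρ (w ++ (L ∷ []))) (ρ (w ++ (R ∷ []))) ≡ true) ×
    (∀ (b : Branch) → ParityAccepting (λ m → priority (ρ (prefix b m))))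
  where open PTA A

Regular : (Tree → Set) → Set
Regular Lang = Σ PTA λ A → ∀ x → (Lang x → Accepts A x) × (Accepts A x → Lang x)

L≤ : Ord → Tree → Set
L≤ α x = WellFounded x × RankLeq x α

-- Let K > n 2ⁿ for an automaton with n states. The tree T hangs, below a chain of l + 1 ones, a
-- spine whose k-th side is a chain of K ones above a tree of rank η; so rank T ≤ η + K + 1 + l
-- ≤ η + ω + l and an automaton for the language accepts T. In an accepting run, the chain of side k
-- has two positions lo < hi with the same state and the same set of states at the right children
-- from there on (pigeonhole). Repeating the segment [lo, hi) k more times in side k, redirecting
-- every right exit to a later position with the same state, gives a tree x′ on which the run is
-- transported; every branch of x′ follows a branch of T up to a reparametrisation that is
-- eventually a shift, so x′ is accepted. But side k of x′ has rank ≥ η + k, so rank x′ > η + ω + l.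

module Submission where

open import Defs
open import Data.Nat using (ℕ; zero; suc; _+_; _*_; _∸_; _≤_; _<_; _≥_; z≤n; s≤s; _≤?_; _<?_; _^_)
import Data.Nat.Properties as ℕₚ
open import Data.Nat.Tactic.RingSolver using (solve-∀)
open import Data.Fin using (Fin; toℕ; fromℕ<; combine; funToFin; finToFun; _≟_) renaming (zero to 0F; suc to sucF)
import Data.Fin.Properties as Finₚ
open import Data.Bool using (true; false)
open import Data.List using (List; []; _∷_; _++_; _∷ʳ_; length; initLast; _∷ʳ′_)
import Data.List.Properties as Listₚ
open import Data.Maybe using (Maybe; just; nothing)
import Data.Maybe.Properties as Maybeₚ
open import Data.Product using (∃-syntax; _×_; _,_; proj₁; proj₂)
open import Data.Sum using (_⊎_; inj₁; inj₂)
open import Data.Unit using (⊤; tt)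
open import Data.Empty using (⊥; ⊥-elim)
open import Function using (_∘_)
open import Relation.Binary.PropositionalEquality
open import Relation.Nullary using (¬_; Dec; yes; no)
open import Relation.Nullary.Decidable using (_×-dec_)

+-cancel-slack : ∀ M X p r E μ → M + X ≤ p + r → r ≤ E + μ → E ≤ X → M ≤ p + μ
+-cancel-slack M X p r E μ bound r≤E+μ E≤X = ℕₚ.+-cancelʳ-≤ X M (p + μ) (begin
  M + X        ≤⟨ bound ⟩
  p + r        ≤⟨ ℕₚ.+-monoʳ-≤ p r≤E+μ ⟩
  p + (E + μ)  ≡⟨ ℕₚ.+-comm p (E + μ) ⟩
  E + μ + p    ≤⟨ ℕₚ.+-monoˡ-≤ p (ℕₚ.+-monoˡ-≤ μ E≤X) ⟩
  X + μ + p    ≡⟨ ℕₚ.+-assoc X μ p ⟩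
  X + (μ + p)  ≡⟨ ℕₚ.+-comm X (μ + p) ⟩
  μ + p + X    ≡⟨ cong (_+ X) (ℕₚ.+-comm μ p) ⟩
  p + μ + X    ∎)
  where open ℕₚ.≤-Reasoning

≤⊎> : ∀ m k → m ≤ k ⊎ ∃[ e ] m ≡ suc k + e
≤⊎> m k with m ≤? k
... | yes m≤k = inj₁ m≤k
... | no  m≰k = inj₂ (m ∸ suc k , sym (ℕₚ.m+[n∸m]≡n (ℕₚ.≰⇒> m≰k)))

-- Brouwer's order by recursion on the left argument; unlike _≤o_ its irreflexivity is provable.
mutual
  _≤ʳ_ : Ord → Ord → Set
  ozero  ≤ʳ b = ⊤
  osuc a ≤ʳ b = a <ʳ b
  olim f ≤ʳ b = ∀ k → f k ≤ʳ b

  _<ʳ_ : Ord → Ord → Set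
  a <ʳ ozero  = ⊥
  a <ʳ osuc b = a ≤ʳ b
  a <ʳ olim f = ∃[ k ] a <ʳ f k

≤ʳ-cocone : ∀ a f k → a ≤ʳ f k → a ≤ʳ olim f
≤ʳ-cocone ozero    f k p = tt
≤ʳ-cocone (osuc a) f k p = k , p
≤ʳ-cocone (olim g) f k p = λ j → ≤ʳ-cocone (g j) f k (p j)

mutual
  ≤ʳ-sucʳ : ∀ a b → a ≤ʳ b → a ≤ʳ osuc b
  ≤ʳ-sucʳ ozero    b p = tt
  ≤ʳ-sucʳ (osuc a) b p = <ʳ⇒≤ʳ a b p
  ≤ʳ-sucʳ (olim g) b p = λ j → ≤ʳ-sucʳ (g j) b (p j)

  <ʳ⇒≤ʳ : ∀ a b → a <ʳ b → a ≤ʳ b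
  <ʳ⇒≤ʳ a (osuc b) p       = ≤ʳ-sucʳ a b p
  <ʳ⇒≤ʳ a (olim f) (k , p) = ≤ʳ-cocone a f k (<ʳ⇒≤ʳ a (f k) p)

≤ʳ-refl : ∀ a → a ≤ʳ a
≤ʳ-refl ozero    = tt
≤ʳ-refl (osuc a) = ≤ʳ-refl a
≤ʳ-refl (olim f) = λ k → ≤ʳ-cocone (f k) f k (≤ʳ-refl (f k))

mutual
  ≤ʳ-trans : ∀ a b c → a ≤ʳ b → b ≤ʳ c → a ≤ʳ c
  ≤ʳ-trans ozero    b c p q = tt
  ≤ʳ-trans (osuc a) b c p q = <ʳ-≤ʳ-trans a b c p q
  ≤ʳ-trans (olim f) b c p q = λ k → ≤ʳ-trans (f k) b c (p k) q

  <ʳ-≤ʳ-trans : ∀ a b c → a <ʳ b → b ≤ʳ c → a <ʳ c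
  <ʳ-≤ʳ-trans a (osuc b) c p       q = ≤ʳ-<ʳ-trans a b c p q
  <ʳ-≤ʳ-trans a (olim f) c (k , p) q = <ʳ-≤ʳ-trans a (f k) c p (q k)

  ≤ʳ-<ʳ-trans : ∀ a b c → a ≤ʳ b → b <ʳ c → a <ʳ c
  ≤ʳ-<ʳ-trans a b (osuc c) p q       = ≤ʳ-trans a b c p q
  ≤ʳ-<ʳ-trans a b (olim g) p (k , q) = k , ≤ʳ-<ʳ-trans a b (g k) p q

<ʳ-irrefl : ∀ a → ¬ a <ʳ a
<ʳ-irrefl (osuc a) p       = <ʳ-irrefl a p
<ʳ-irrefl (olim f) (k , p) =
  <ʳ-irrefl (f k) (≤ʳ-<ʳ-trans (f k) (olim f) (f k) (≤ʳ-cocone (f k) f k (≤ʳ-refl (f k))) p)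

≤o⇒≤ʳ : ∀ {a b} → a ≤o b → a ≤ʳ b
≤o⇒≤ʳ ≤-zero                        = tt
≤o⇒≤ʳ (≤-trans {a} {b} {c} p q)     = ≤ʳ-trans a b c (≤o⇒≤ʳ p) (≤o⇒≤ʳ q)
≤o⇒≤ʳ (≤-suc-mono p)                = ≤o⇒≤ʳ p
≤o⇒≤ʳ (≤-cocone {a} {f} k p)        = ≤ʳ-cocone a f k (≤o⇒≤ʳ p)
≤o⇒≤ʳ (≤-limiting h)                = λ k → ≤o⇒≤ʳ (h k)

<o-irrefl : ∀ a → ¬ a <o a
<o-irrefl a p = <ʳ-irrefl a (≤o⇒≤ʳ p)

≤o-refl : ∀ a → a ≤o a
≤o-refl ozero    = ≤-zero
≤o-refl (osuc a) = ≤-suc-mono (≤o-refl a)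
≤o-refl (olim f) = ≤-limiting (λ k → ≤-cocone k (≤o-refl (f k)))

≤o-sucʳ : ∀ a → a ≤o osuc a
≤o-sucʳ ozero    = ≤-zero
≤o-sucʳ (osuc a) = ≤-suc-mono (≤o-sucʳ a)
≤o-sucʳ (olim f) = ≤-limiting (λ k → ≤-trans (≤o-sucʳ (f k)) (≤-suc-mono (≤-cocone k (≤o-refl (f k)))))

+-fin-monoˡ : ∀ {a b} m → a ≤o b → (a +o fin m) ≤o (b +o fin m)
+-fin-monoˡ zero    p = p
+-fin-monoˡ (suc m) p = ≤-suc-mono (+-fin-monoˡ m p)

+-fin-monoʳ : ∀ a {m n} → m ≤ n → (a +o fin m) ≤o (a +o fin n)
+-fin-monoʳ a {zero}  {zero}  _       = ≤o-refl a
+-fin-monoʳ a {zero}  {suc n} _       = ≤-trans (+-fin-monoʳ a {zero} {n} z≤n) (≤o-sucʳ (a +o fin n))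
+-fin-monoʳ a {suc m} {suc n} (s≤s p) = ≤-suc-mono (+-fin-monoʳ a p)

+-fin-suc : ∀ a m → (a +o fin (suc m)) ≡ (osuc a +o fin m)
+-fin-suc a zero    = refl
+-fin-suc a (suc m) = cong osuc (+-fin-suc a m)

lefts : ℕ → Node
lefts zero    = []
lefts (suc n) = L ∷ lefts n

rights : ℕ → Node
rights zero    = []
rights (suc n) = R ∷ rights n

blank : Tree
blank _ = false

stem : Tree → Tree
stem t []      = true
stem t (L ∷ w) = t w
stem t (R ∷ w) = false

stems : ℕ → Tree → Tree
stems zero    t = t
stems (suc m) t = stem (stems m t)

spine : (ℕ → Tree) → Tree
spine g []      = false
spine g (L ∷ w) = g 0 w
spine g (R ∷ w) = spine (g ∘ suc) w

treeOfRank : Ord → Tree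
treeOfRank ozero    = blank
treeOfRank (osuc a) = stem (treeOfRank a)
treeOfRank (olim f) = spine (treeOfRank ∘ f)

spine-at : ∀ g k u → spine g (rights k ++ L ∷ u) ≡ g k u
spine-at g zero    u = refl
spine-at g (suc k) u = spine-at (g ∘ suc) k u

stems-at : ∀ m t u → stems m t (lefts m ++ u) ≡ t u
stems-at zero    t u = refl
stems-at (suc m) t u = stems-at m t u

stems-lefts : ∀ m t i → i < m → stems m t (lefts i) ≡ true
stems-lefts (suc m) t zero    _       = refl
stems-lefts (suc m) t (suc i) (s≤s p) = stems-lefts m t i p

-- Upper bounds on the rank

rank≤-blank : ∀ a → RankLeq blank a
rank≤-blank a = (λ u ()) , (λ u ()) , (λ u v ())

rank≤-mono : ∀ {t a b} → RankLeq t a → a ≤o b → RankLeq t b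
rank≤-mono (C , bounded , decreasing) a≤b = C , (λ u p → ≤-trans (bounded u p) a≤b) , decreasing

rank≤-stem : ∀ {t a} → RankLeq t a → RankLeq (stem t) (osuc a)
rank≤-stem {t} {a} (C , bounded , decreasing) = C′ , bounded′ , decreasing′
  where
  C′ : ∀ u → stem t u ≡ true → Ord
  C′ []      p = a
  C′ (L ∷ u) p = C u p

  bounded′ : ∀ u p → C′ u p <o osuc a
  bounded′ []      p = ≤o-refl (osuc a)
  bounded′ (L ∷ u) p = ≤-trans (bounded u p) (≤o-sucʳ a)

  decreasing′ : ∀ u v p q → u ⊏ v → C′ u p <o C′ v q
  decreasing′ u       []      p q ([] , w≢[] , _)        = ⊥-elim (w≢[] refl)
  decreasing′ (L ∷ u) []      p q (_ ∷ _ , _ , refl)     = bounded u p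
  decreasing′ _       (L ∷ v) p q (w , w≢[] , refl)      = decreasing (v ++ w) v p q (w , w≢[] , refl)

rank≤-stems : ∀ {t a} m → RankLeq t a → RankLeq (stems m t) (a +o fin m)
rank≤-stems zero    r = r
rank≤-stems (suc m) r = rank≤-stem (rank≤-stems m r)

rank≤-spine : ∀ {a} g → (∀ k → RankLeq (g k) a) → RankLeq (spine g) a
rank≤-spine {a} g r = C g r , bounded g r , decreasing g r
  where
  C : ∀ g → (∀ k → RankLeq (g k) a) → ∀ u → spine g u ≡ true → Ord
  C g r (L ∷ u) p = proj₁ (r 0) u p
  C g r (R ∷ u) p = C (g ∘ suc) (r ∘ suc) u p

  bounded : ∀ g (r : ∀ k → RankLeq (g k) a) u p → C g r u p <o a
  bounded g r (L ∷ u) p = proj₁ (proj₂ (r 0)) u p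
  bounded g r (R ∷ u) p = bounded (g ∘ suc) (r ∘ suc) u p

  decreasing : ∀ g (r : ∀ k → RankLeq (g k) a) u v p q → u ⊏ v → C g r u p <o C g r v q
  decreasing g r _ (L ∷ v) p q (w , w≢[] , refl) = proj₂ (proj₂ (r 0)) (v ++ w) v p q (w , w≢[] , refl)
  decreasing g r _ (R ∷ v) p q (w , w≢[] , refl) = decreasing (g ∘ suc) (r ∘ suc) (v ++ w) v p q (w , w≢[] , refl)

rank≤-treeOfRank : ∀ a → RankLeq (treeOfRank a) a
rank≤-treeOfRank ozero    = rank≤-blank ozero
rank≤-treeOfRank (osuc a) = rank≤-stem (rank≤-treeOfRank a)
rank≤-treeOfRank (olim f) =
  rank≤-spine (treeOfRank ∘ f) (λ k → rank≤-mono (rank≤-treeOfRank (f k)) (≤-cocone k (≤o-refl (f k))))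

-- Lower bounds on the rank

RankGeq : Tree → Ord → Set
RankGeq t a = ∀ γ (C : ∀ u → t u ≡ true → Ord) → (∀ u p → C u p <o γ) →
              (∀ u v p q → u ⊏ v → C u p <o C v q) → a ≤o γ

¬rank≤-of-rank≥-suc : ∀ {t a} → RankGeq t (osuc a) → ¬ RankLeq t a
¬rank≤-of-rank≥-suc {a = a} big (C , bounded , decreasing) = <o-irrefl a (big a C bounded decreasing)

rank≥-mono : ∀ {t a b} → b ≤o a → RankGeq t a → RankGeq t b
rank≥-mono b≤a big γ C bounded decreasing = ≤-trans b≤a (big γ C bounded decreasing)

rank≥-cong : ∀ {t t′ a} → (∀ u → t u ≡ t′ u) → RankGeq t a → RankGeq t′ a
rank≥-cong t≗t′ big γ C bounded decreasing =
  big γ (λ u p → C u (trans (sym (t≗t′ u)) p)) (λ u _ → bounded u _) (λ u v _ _ → decreasing u v _ _)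

rank≥-lim : ∀ {t} f → (∀ k → RankGeq t (f k)) → RankGeq t (olim f)
rank≥-lim f big γ C bounded decreasing = ≤-limiting (λ k → big k γ C bounded decreasing)

rank≥-subtree : ∀ {t a} v → RankGeq (λ u → t (v ++ u)) a → RankGeq t a
rank≥-subtree v big γ C bounded decreasing =
  big γ (λ u → C (v ++ u)) (λ u → bounded (v ++ u))
    (λ u w p q (z , z≢[] , u≡w++z) →
       decreasing (v ++ u) (v ++ w) p q (z , z≢[] , trans (cong (v ++_) u≡w++z) (sym (Listₚ.++-assoc v w z))))

rank≥-stem : ∀ {t a} → t [] ≡ true → RankGeq (λ u → t (L ∷ u)) a → RankGeq t (osuc a)
rank≥-stem root big γ C bounded decreasing =
  ≤-trans (≤-suc-mono (big (C [] root) (λ u → C (L ∷ u))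
                         (λ u p → decreasing (L ∷ u) [] p root (L ∷ u , (λ ()) , refl))
                         (λ u v p q (w , w≢[] , e) → decreasing (L ∷ u) (L ∷ v) p q (w , w≢[] , cong (L ∷_) e))))
          (bounded [] root)

rank≥-lefts : ∀ {t a} m → (∀ i → i < m → t (lefts i) ≡ true) →
              RankGeq (λ u → t (lefts m ++ u)) a → RankGeq t (a +o fin m)
rank≥-lefts zero    chain big = big
rank≥-lefts (suc m) chain big =
  rank≥-stem (chain 0 (s≤s z≤n)) (rank≥-lefts m (λ i p → chain (suc i) (s≤s p)) big)

rank≥-spine : ∀ g k {a} → RankGeq (g k) a → RankGeq (spine g) a
rank≥-spine g k big = rank≥-subtree (rights k ++ L ∷ []) (rank≥-cong at big)
  where
  at : ∀ u → g k u ≡ spine g ((rights k ++ L ∷ []) ++ u)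
  at u = trans (sym (spine-at g k u)) (cong (spine g) (sym (Listₚ.++-assoc (rights k) (L ∷ []) u)))

rank≥-treeOfRank : ∀ a → RankGeq (treeOfRank a) a
rank≥-treeOfRank ozero    = λ _ _ _ _ → ≤-zero
rank≥-treeOfRank (osuc a) = rank≥-stem refl (rank≥-treeOfRank a)
rank≥-treeOfRank (olim f) = rank≥-lim f (λ k → rank≥-spine (treeOfRank ∘ f) k (rank≥-treeOfRank (f k)))

tail : Branch → Branch
tail b = b ∘ suc

drop : ℕ → Branch → Branch
drop d b j = b (d + j)

-- Prefixes built by consing, which suits structural recursion on trees better than Defs.prefix.
path : Branch → ℕ → Node
path b zero    = []
path b (suc m) = b 0 ∷ path (tail b) m

path-suc : ∀ b m → path b (suc m) ≡ path b m ++ b m ∷ []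
path-suc b zero    = refl
path-suc b (suc m) = cong (b 0 ∷_) (path-suc (tail b) m)

prefix≡path : ∀ b m → prefix b m ≡ path b m
prefix≡path b zero    = refl
prefix≡path b (suc m) = trans (cong (_++ b m ∷ []) (prefix≡path b m)) (sym (path-suc b m))

path-restrict : ∀ {b b′} m → (∀ j → j < m → b j ≡ b′ j) → path b m ≡ path b′ m
path-restrict zero    _  = refl
path-restrict (suc m) eq = cong₂ _∷_ (eq 0 (s≤s z≤n)) (path-restrict m (λ j p → eq (suc j) (s≤s p)))

path-+ : ∀ b d m → path b (d + m) ≡ path b d ++ path (drop d b) m
path-+ b zero    m = refl
path-+ b (suc d) m = cong (b 0 ∷_) (path-+ (tail b) d m)

length-path : ∀ b m → length (path b m) ≡ m
length-path b zero    = refl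
length-path b (suc m) = cong suc (length-path (tail b) m)

HitsOften : Tree → Branch → Set
HitsOften x b = ∀ n → ∃[ m ] n ≤ m × x (path b m) ≡ true

WellFounded′ : Tree → Set
WellFounded′ x = ∀ b → ¬ HitsOften x b

WellFounded′⇒WellFounded : ∀ x → WellFounded′ x → WellFounded x
WellFounded′⇒WellFounded x wf (b , hits) =
  wf b (λ n → let (m , n≤m , xm) = hits n in m , n≤m , trans (cong x (sym (prefix≡path b m))) xm)

hitsOften-tail : ∀ {x} b → HitsOften x b → HitsOften (λ w → x (b 0 ∷ w)) (tail b)
hitsOften-tail b hits n with hits (suc n)
... | suc m , s≤s n≤m , xm = m , n≤m , xm

wf-blank : WellFounded′ blank
wf-blank b hits with hits 0
... | _ , _ , ()

wf-stem : ∀ {t} → WellFounded′ t → WellFounded′ (stem t)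
wf-stem {t} wf b hits with b 0 | hitsOften-tail {stem t} b hits
... | L | hits′ = wf (tail b) hits′
... | R | hits′ with hits′ 0
...   | _ , _ , ()

wf-stems : ∀ {t} m → WellFounded′ t → WellFounded′ (stems m t)
wf-stems zero    wf = wf
wf-stems (suc m) wf = wf-stem (wf-stems m wf)

wf-spine : ∀ g → (∀ k → WellFounded′ (g k)) → WellFounded′ (spine g)
wf-spine g wf b hits = let (m , _ , xm) = hits 0 in descend m g wf b hits xm
  where
  descend : ∀ m g → (∀ k → WellFounded′ (g k)) → ∀ b → HitsOften (spine g) b → spine g (path b m) ≡ true → ⊥
  descend (suc m) g wf b hits xm with b 0 | hitsOften-tail {spine g} b hits
  ... | L | hits′ = wf 0 (tail b) hits′
  ... | R | hits′ = descend m (g ∘ suc) (wf ∘ suc) (tail b) hits′ xm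

wf-treeOfRank : ∀ a → WellFounded′ (treeOfRank a)
wf-treeOfRank ozero    = wf-blank
wf-treeOfRank (osuc a) = wf-stem (wf-treeOfRank a)
wf-treeOfRank (olim f) = wf-spine (treeOfRank ∘ f) (wf-treeOfRank ∘ f)

lefts-suc : ∀ j w → lefts (suc j) ++ w ≡ lefts j ++ L ∷ w
lefts-suc zero    w = refl
lefts-suc (suc j) w = cong (L ∷_) (lefts-suc j w)

lefts-snoc : ∀ r → lefts (suc r) ≡ lefts r ++ L ∷ []
lefts-snoc r = trans (sym (Listₚ.++-identityʳ (lefts (suc r)))) (lefts-suc r [])

length-lefts : ∀ m → length (lefts m) ≡ m
length-lefts zero    = refl
length-lefts (suc m) = cong suc (length-lefts m)

length-rights : ∀ m → length (rights m) ≡ m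
length-rights zero    = refl
length-rights (suc m) = cong suc (length-rights m)

++-injective : ∀ (xs ys xs′ ys′ : Node) → xs ++ ys ≡ xs′ ++ ys′ → length xs ≡ length xs′ → xs ≡ xs′ × ys ≡ ys′
++-injective []       ys []         ys′ eq _ = refl , eq
++-injective (x ∷ xs) ys (x′ ∷ xs′) ys′ eq len with Listₚ.∷-injective eq
... | refl , eq′ =
  let (xs≡xs′ , ys≡ys′) = ++-injective xs ys xs′ ys′ eq′ (ℕₚ.suc-injective len) in cong (x ∷_) xs≡xs′ , ys≡ys′

LeftsBelow : Branch → ℕ → Set
LeftsBelow c n = ∀ j → j < n → c j ≡ L

FirstRightAt : Branch → ℕ → Set
FirstRightAt c i = c i ≡ R × LeftsBelow c i

firstRight : ∀ c n → (∃[ i ] i < n × FirstRightAt c i) ⊎ LeftsBelow c n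
firstRight c zero = inj₂ (λ j ())
firstRight c (suc n) with firstRight c n
... | inj₁ (i , i<n , first) = inj₁ (i , ℕₚ.m<n⇒m<1+n i<n , first)
... | inj₂ below with c n in cn
...   | R = inj₁ (n , ℕₚ.≤-refl , cn , below)
...   | L = inj₂ below′
  where
  below′ : LeftsBelow c (suc n)
  below′ j j<1+n with ℕₚ.m≤n⇒m<n∨m≡n (ℕₚ.≤-pred j<1+n)
  ... | inj₁ j<n   = below j j<n
  ... | inj₂ refl  = cn

path-lefts : ∀ c m → LeftsBelow c m → path c m ≡ lefts m
path-lefts c zero    _     = refl
path-lefts c (suc m) below = cong₂ _∷_ (below 0 (s≤s z≤n)) (path-lefts (tail c) m (λ j p → below (suc j) (s≤s p)))

path-lefts-≤ : ∀ c {n} m → m ≤ n → LeftsBelow c n → path c m ≡ lefts m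
path-lefts-≤ c m m≤n below = path-lefts c m (λ j j<m → below j (ℕₚ.<-≤-trans j<m m≤n))

leftsThen : ℕ → Branch → Branch
leftsThen P c j with j <? P
... | yes _ = L
... | no  _ = c (j ∸ P)

leftsThen-below : ∀ P c → LeftsBelow (leftsThen P c) P
leftsThen-below P c j j<P with j <? P
... | yes _   = refl
... | no j≮P  = ⊥-elim (j≮P j<P)

drop-leftsThen : ∀ P c e → drop P (leftsThen P c) e ≡ c e
drop-leftsThen P c e with P + e <? P
... | yes P+e<P = ⊥-elim (ℕₚ.m+n≮m P e P+e<P)
... | no  _     = cong c (ℕₚ.m+n∸m≡n P e)

path-leftsThen : ∀ P c e → path (leftsThen P c) (P + e) ≡ lefts P ++ path c e
path-leftsThen P c e =
  trans (path-+ (leftsThen P c) P e)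
        (cong₂ _++_ (path-lefts _ P (leftsThen-below P c)) (path-restrict e (λ j _ → drop-leftsThen P c j)))

-- Pumping a segment [lo, lo + d) of the left chain t more times

module Pump (lo d₀ t : ℕ) (exitTo : ℕ → ℕ) (exitTo-beyond : ∀ y → lo + suc d₀ ≤ exitTo y) where

  d : ℕ
  d = suc d₀

  hi : ℕ
  hi = lo + d

  extra : ℕ
  extra = t * d

  end : ℕ
  end = hi + extra

  source′ : ℕ → ℕ → ℕ
  source′ zero    i = i
  source′ (suc s) i with i <? hi
  ... | yes _ = i
  ... | no  _ = source′ s (i ∸ d)

  source : ℕ → ℕ
  source = source′ t

  source′-below : ∀ s i → i < hi → source′ s i ≡ i
  source′-below zero    i _    = refl
  source′-below (suc s) i i<hi with i <? hi
  ... | yes _    = refl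
  ... | no  i≮hi = ⊥-elim (i≮hi i<hi)

  source′-beyond : ∀ s e → source′ s (hi + e + s * d) ≡ hi + e
  source′-beyond zero    e = ℕₚ.+-identityʳ (hi + e)
  source′-beyond (suc s) e with hi + e + (d + s * d) <? hi
  ... | yes lt = ⊥-elim (ℕₚ.m+n≮m hi (e + (d + s * d)) (subst (_< hi) (ℕₚ.+-assoc hi e _) lt))
  ... | no  _  = trans (cong (source′ s) drop-d) (source′-beyond s e)
    where
    drop-d : hi + e + (d + s * d) ∸ d ≡ hi + e + s * d
    drop-d = trans (cong (_∸ d) (reorder hi e s d)) (ℕₚ.m+n∸n≡m _ d)
      where
      reorder : ∀ h e s d → h + e + (d + s * d) ≡ h + e + s * d + d
      reorder = solve-∀

  source′-loop : ∀ s i → hi ≤ i → i < hi + s * d → lo ≤ source′ s i × source′ s i < hi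
  source′-loop zero    i hi≤i i<hi+0 = ⊥-elim (ℕₚ.≤⇒≯ hi≤i (subst (i <_) (ℕₚ.+-identityʳ hi) i<hi+0))
  source′-loop (suc s) i hi≤i i<bound with i <? hi
  ... | yes i<hi = ⊥-elim (ℕₚ.≤⇒≯ hi≤i i<hi)
  ... | no  _ with i ∸ d <? hi
  ...   | yes i-d<hi = subst (λ z → lo ≤ z × z < hi) (sym (source′-below s (i ∸ d) i-d<hi))
                         (subst (_≤ i ∸ d) (ℕₚ.m+n∸n≡m lo d) (ℕₚ.∸-monoˡ-≤ d hi≤i) , i-d<hi)
  ...   | no  i-d≮hi = source′-loop s (i ∸ d) (ℕₚ.≮⇒≥ i-d≮hi) i-d<bound
    where
    i-d<bound : i ∸ d < hi + s * d
    i-d<bound = ℕₚ.+-cancelʳ-< d (i ∸ d) (hi + s * d)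
                  (subst (_< hi + s * d + d) (sym (ℕₚ.m∸n+n≡m (ℕₚ.≤-trans (ℕₚ.m≤n+m d lo) hi≤i)))
                    (subst (i <_) (reorder hi s d) i<bound))
      where
      reorder : ∀ h s d → h + (d + s * d) ≡ h + s * d + d
      reorder = solve-∀

  source′-bound : ∀ s i → i ≤ source′ s i + s * d
  source′-bound zero    i = ℕₚ.m≤m+n i 0
  source′-bound (suc s) i with i <? hi
  ... | yes _    = ℕₚ.m≤m+n i _
  ... | no  i≮hi = subst (i ≤_) (reorder (source′ s (i ∸ d)) s d)
                     (ℕₚ.≤-trans (ℕₚ.≤-reflexive (sym (ℕₚ.m∸n+n≡m d≤i)))
                                (ℕₚ.+-monoˡ-≤ d (source′-bound s (i ∸ d))))
    where
    d≤i : d ≤ i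
    d≤i = ℕₚ.≤-trans (ℕₚ.m≤n+m d lo) (ℕₚ.≮⇒≥ i≮hi)
    reorder : ∀ r s d → r + s * d + d ≡ r + (d + s * d)
    reorder = solve-∀

  source′-suc : ∀ s i → source′ s (suc i) ≡ suc (source′ s i) ⊎ (suc (source′ s i) ≡ hi × source′ s (suc i) ≡ lo)
  source′-suc zero    i = inj₁ refl
  source′-suc (suc s) i with suc i <? hi | i <? hi
  ... | yes _     | yes _    = inj₁ refl
  ... | yes 1+i<hi | no i≮hi = ⊥-elim (i≮hi (ℕₚ.<-trans (ℕₚ.n<1+n i) 1+i<hi))
  ... | no 1+i≮hi | yes i<hi =
    inj₂ (1+i≡hi , trans (cong (source′ s) wrap) (source′-below s lo (ℕₚ.m<m+n lo (s≤s z≤n))))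
    where
    1+i≡hi : suc i ≡ hi
    1+i≡hi = ℕₚ.≤-antisym i<hi (ℕₚ.≮⇒≥ 1+i≮hi)
    wrap : suc i ∸ d ≡ lo
    wrap = trans (cong (_∸ d) 1+i≡hi) (ℕₚ.m+n∸n≡m lo d)
  ... | no _ | no i≮hi rewrite ℕₚ.+-∸-assoc 1 (ℕₚ.≤-trans (ℕₚ.m≤n+m d lo) (ℕₚ.≮⇒≥ i≮hi)) = source′-suc s (i ∸ d)

  source-zero : source 0 ≡ 0
  source-zero = source′-below t 0 (ℕₚ.≤-trans (s≤s z≤n) (ℕₚ.m≤n+m d lo))

  source-end+ : ∀ e → source (end + e) ≡ hi + e
  source-end+ e = trans (cong source (reorder hi extra e)) (source′-beyond t e)
    where
    reorder : ∀ h l e → h + l + e ≡ h + e + l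
    reorder = solve-∀

  source-<end : ∀ i → i < end → source i < hi
  source-<end i i<end with i <? hi
  ... | yes i<hi = subst (_< hi) (sym (source′-below t i i<hi)) i<hi
  ... | no  i≮hi = proj₂ (source′-loop t i (ℕₚ.≮⇒≥ i≮hi) i<end)

  source-≤end : ∀ i → i ≤ end → source i ≤ hi
  source-≤end i i≤end with ℕₚ.m≤n⇒m<n∨m≡n i≤end
  ... | inj₁ i<end = ℕₚ.<⇒≤ (source-<end i i<end)
  ... | inj₂ refl  = ℕₚ.≤-reflexive (trans (cong source (sym (ℕₚ.+-identityʳ end))) (trans (source-end+ 0) (ℕₚ.+-identityʳ hi)))

  exitSource : ℕ → ℕ
  exitSource i with hi ≤? i | i <? end
  ... | yes _ | yes _ = exitTo (source i)
  ... | _     | _     = source i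

  exitSource-loop : ∀ i → hi ≤ i → i < end → exitSource i ≡ exitTo (source i)
  exitSource-loop i hi≤i i<end with hi ≤? i | i <? end
  ... | yes _    | yes _    = refl
  ... | no hi≰i  | _        = ⊥-elim (hi≰i hi≤i)
  ... | yes _    | no i≮end = ⊥-elim (i≮end i<end)

  exitSource-below : ∀ i → i < hi → exitSource i ≡ source i
  exitSource-below i i<hi with hi ≤? i | i <? end
  ... | yes hi≤i | yes _ = ⊥-elim (ℕₚ.≤⇒≯ hi≤i i<hi)
  ... | yes _    | no _  = refl
  ... | no _     | _     = refl

  exitSource-beyond : ∀ i → end ≤ i → exitSource i ≡ source i
  exitSource-beyond i end≤i with hi ≤? i | i <? end
  ... | yes _ | yes i<end = ⊥-elim (ℕₚ.≤⇒≯ end≤i i<end)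
  ... | yes _ | no _      = refl
  ... | no _  | _         = refl

  exitSource-cases : ∀ i → (hi ≤ i × i < end × exitSource i ≡ exitTo (source i)) ⊎ exitSource i ≡ source i
  exitSource-cases i with hi ≤? i | i <? end
  ... | yes hi≤i | yes i<end = inj₁ (hi≤i , i<end , refl)
  ... | yes _    | no _      = inj₂ refl
  ... | no _     | _         = inj₂ refl

  -- The i-th node of the pumped chain copies the (source i)-th node of the original one, and the
  -- subtree leaving it to the right copies the one leaving at exitSource i.
  pumpFrom : ℕ → Node → Node
  pumpFrom i []      = lefts (source i)
  pumpFrom i (L ∷ w) = pumpFrom (suc i) w
  pumpFrom i (R ∷ w) = lefts (exitSource i) ++ R ∷ w

  pump : Node → Node
  pump = pumpFrom 0

  pumpFrom-lefts : ∀ i j w → pumpFrom i (lefts j ++ w) ≡ pumpFrom (j + i) w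
  pumpFrom-lefts i zero    w = refl
  pumpFrom-lefts i (suc j) w = trans (pumpFrom-lefts (suc i) j w) (cong (λ z → pumpFrom z w) (ℕₚ.+-suc j i))

  pump-lefts : ∀ m → pump (lefts m) ≡ lefts (source m)
  pump-lefts m = trans (cong pump (sym (Listₚ.++-identityʳ (lefts m))))
                       (trans (pumpFrom-lefts 0 m []) (cong (λ z → lefts (source z)) (ℕₚ.+-identityʳ m)))

  pumpFrom-beyond : ∀ e w → pumpFrom (hi + e + extra) w ≡ lefts (hi + e) ++ w
  pumpFrom-beyond e []      = trans (cong lefts (source′-beyond t e)) (sym (Listₚ.++-identityʳ (lefts (hi + e))))
  pumpFrom-beyond e (L ∷ w) = begin
    pumpFrom (suc (hi + e + extra)) w ≡⟨ cong (λ z → pumpFrom z w) (reorder hi e extra) ⟩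
    pumpFrom (hi + suc e + extra) w   ≡⟨ pumpFrom-beyond (suc e) w ⟩
    lefts (hi + suc e) ++ w           ≡⟨ cong (λ z → lefts z ++ w) (ℕₚ.+-suc hi e) ⟩
    lefts (suc (hi + e)) ++ w         ≡⟨ lefts-suc (hi + e) w ⟩
    lefts (hi + e) ++ L ∷ w           ∎
    where
    open ≡-Reasoning
    reorder : ∀ h e l → suc (h + e + l) ≡ h + suc e + l
    reorder = solve-∀
  pumpFrom-beyond e (R ∷ w) = cong (λ z → lefts z ++ R ∷ w)
    (trans (exitSource-beyond (hi + e + extra) (ℕₚ.+-monoˡ-≤ extra (ℕₚ.m≤m+n hi e))) (source′-beyond t e))

  -- Runs are preserved because the pumped segment starts and ends in the same state, and every exit
  -- state of the segment recurs beyond it.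
  pumpFrom-snoc : ∀ {X : Set} (σ : Node → X) → σ (lefts lo) ≡ σ (lefts hi) →
                  (∀ y → lo ≤ y → y < hi → σ (lefts (exitTo y) ++ R ∷ []) ≡ σ (lefts y ++ R ∷ [])) →
                  ∀ i w dir → σ (pumpFrom i (w ++ dir ∷ [])) ≡ σ (pumpFrom i w ++ dir ∷ [])
  pumpFrom-snoc σ loop exits i [] L with source′-suc t i
  ... | inj₁ next          = cong σ (trans (cong lefts next) (lefts-snoc (source i)))
  ... | inj₂ (last , wrap) = trans (cong (σ ∘ lefts) wrap)
                               (trans loop (cong σ (trans (cong lefts (sym last)) (lefts-snoc (source i)))))
  pumpFrom-snoc σ loop exits i [] R with exitSource-cases i
  ... | inj₁ (hi≤i , i<end , e) =
    trans (cong (λ z → σ (lefts z ++ R ∷ [])) e)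
          (exits (source i) (proj₁ (source′-loop t i hi≤i i<end)) (proj₂ (source′-loop t i hi≤i i<end)))
  ... | inj₂ e = cong (λ z → σ (lefts z ++ R ∷ [])) e
  pumpFrom-snoc σ loop exits i (L ∷ w) dir = pumpFrom-snoc σ loop exits (suc i) w dir
  pumpFrom-snoc σ loop exits i (R ∷ w) dir = cong σ (sym (Listₚ.++-assoc (lefts (exitSource i)) (R ∷ w) (dir ∷ [])))

  source<bound : ∀ b → hi ≤ b → ∀ i → i < b + extra → source i < b
  source<bound b hi≤b i i<b+extra with ≤⊎> i end
  ... | inj₁ i≤end with ℕₚ.m≤n⇒m<n∨m≡n i≤end
  ...   | inj₁ i<end = ℕₚ.<-≤-trans (source-<end i i<end) hi≤b
  ...   | inj₂ refl  = ℕₚ.≤-<-trans (source-≤end i i≤end) (ℕₚ.+-cancelʳ-< extra hi b i<b+extra)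
  source<bound b hi≤b i i<b+extra | inj₂ (e , refl) =
    subst (_< b) (sym (trans (cong source (sym (ℕₚ.+-suc end e))) (source-end+ (suc e))))
      (ℕₚ.+-cancelʳ-< extra (hi + suc e) b (subst (_< b + extra) (reorder hi extra e) i<b+extra))
    where
    reorder : ∀ h l e → suc (h + l + e) ≡ h + suc e + l
    reorder = solve-∀

  rank≥-pumped : ∀ b x a → hi ≤ b → RankGeq x a → RankGeq (λ u → stems b x (pump u)) (a +o fin (b + extra))
  rank≥-pumped b x a hi≤b big = rank≥-lefts (b + extra) chain (rank≥-cong top big)
    where
    open ≡-Reasoning
    chain : ∀ i → i < b + extra → stems b x (pump (lefts i)) ≡ true
    chain i i<b+extra = trans (cong (stems b x) (pump-lefts i)) (stems-lefts b x (source i) (source<bound b hi≤b i i<b+extra))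
    e = b ∸ hi
    hi+e≡b : hi + e ≡ b
    hi+e≡b = ℕₚ.m+[n∸m]≡n hi≤b
    top : ∀ u → x u ≡ stems b x (pump (lefts (b + extra) ++ u))
    top u = sym (begin
      stems b x (pump (lefts (b + extra) ++ u))  ≡⟨ cong (stems b x) (pumpFrom-lefts 0 (b + extra) u) ⟩
      stems b x (pumpFrom (b + extra + 0) u)     ≡⟨ cong (λ z → stems b x (pumpFrom z u)) (trans (ℕₚ.+-identityʳ (b + extra)) (cong (_+ extra) (sym hi+e≡b))) ⟩
      stems b x (pumpFrom (hi + e + extra) u)    ≡⟨ cong (stems b x) (pumpFrom-beyond e u) ⟩
      stems b x (lefts (hi + e) ++ u)            ≡⟨ cong (λ z → stems b x (lefts z ++ u)) hi+e≡b ⟩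
      stems b x (lefts b ++ u)                   ≡⟨ stems-at b x u ⟩
      x u                                        ∎)

  Shape : Branch → Set
  Shape c = (∃[ i ] i < end × FirstRightAt c i) ⊎ LeftsBelow c end

  shape : ∀ c → Shape c
  shape c = firstRight c end

  reparamExit : ℕ → ℕ → ℕ
  reparamExit i m with m ≤? i
  ... | yes _ = source m
  ... | no  _ = exitSource i + (m ∸ i)

  image : ∀ c → Shape c → Branch
  image c (inj₁ (i , _)) = leftsThen (exitSource i) (drop i c)
  image c (inj₂ _)       = leftsThen hi (drop end c)

  reparam : ∀ c → Shape c → ℕ → ℕ
  reparam c (inj₁ (i , _)) = reparamExit i
  reparam c (inj₂ _)       = source

  reparamExit-≤ : ∀ i m → m ≤ i → reparamExit i m ≡ source m
  reparamExit-≤ i m m≤i with m ≤? i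
  ... | yes _   = refl
  ... | no m≰i  = ⊥-elim (m≰i m≤i)

  reparamExit-> : ∀ i e → reparamExit i (suc i + e) ≡ suc (exitSource i) + e
  reparamExit-> i e with suc i + e ≤? i
  ... | yes le = ⊥-elim (ℕₚ.m+n≮m i e le)
  ... | no  _  = trans (cong (λ z → exitSource i + (z ∸ i)) (sym (ℕₚ.+-suc i e)))
                       (trans (cong (exitSource i +_) (ℕₚ.m+n∸m≡n i (suc e))) (ℕₚ.+-suc (exitSource i) e))

  -- Before the exit the pumped positions stay below hi, and exitTo sends exits beyond hi.
  source≤exitSource : ∀ m i → m ≤ i → i < end → source m ≤ exitSource i
  source≤exitSource m i m≤i i<end with i <? hi
  ... | yes i<hi = subst₂ _≤_ (sym (source′-below t m (ℕₚ.≤-<-trans m≤i i<hi)))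
                     (sym (trans (exitSource-below i i<hi) (source′-below t i i<hi))) m≤i
  ... | no  i≮hi = ℕₚ.≤-trans (ℕₚ.<⇒≤ (source-<end m (ℕₚ.≤-<-trans m≤i i<end)))
                     (subst (hi ≤_) (sym (exitSource-loop i (ℕₚ.≮⇒≥ i≮hi) i<end)) (exitTo-beyond _))

  open ≡-Reasoning

  pump-path-beforeExit : ∀ c i → i < end → LeftsBelow c i → ∀ m → m ≤ i →
                         pump (path c m) ≡ path (leftsThen (exitSource i) (drop i c)) (reparamExit i m)
  pump-path-beforeExit c i i<end below m m≤i = begin
    pump (path c m)               ≡⟨ cong pump (path-lefts-≤ c m m≤i below) ⟩
    pump (lefts m)                ≡⟨ pump-lefts m ⟩
    lefts (source m)              ≡⟨ sym (path-lefts-≤ c′ (source m) (source≤exitSource m i m≤i i<end) (leftsThen-below _ _)) ⟩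
    path c′ (source m)            ≡⟨ cong (path c′) (sym (reparamExit-≤ i m m≤i)) ⟩
    path c′ (reparamExit i m)     ∎
    where c′ = leftsThen (exitSource i) (drop i c)

  pump-path-afterExit : ∀ c i → FirstRightAt c i → ∀ e →
                        pump (path c (suc i + e)) ≡ path (leftsThen (exitSource i) (drop i c)) (reparamExit i (suc i + e))
  pump-path-afterExit c i (right , below) e = begin
    pump (path c (suc i + e))                 ≡⟨ cong (pump ∘ path c) (sym (ℕₚ.+-suc i e)) ⟩
    pump (path c (i + suc e))                 ≡⟨ cong pump (path-+ c i (suc e)) ⟩
    pump (path c i ++ c (i + 0) ∷ w)          ≡⟨ cong (λ z → pump (z ++ c (i + 0) ∷ w)) (path-lefts c i below) ⟩
    pump (lefts i ++ c (i + 0) ∷ w)           ≡⟨ cong (λ z → pump (lefts i ++ z ∷ w)) right′ ⟩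
    pump (lefts i ++ R ∷ w)                   ≡⟨ pumpFrom-lefts 0 i (R ∷ w) ⟩
    lefts (exitSource (i + 0)) ++ R ∷ w       ≡⟨ cong (λ z → lefts (exitSource z) ++ R ∷ w) (ℕₚ.+-identityʳ i) ⟩
    lefts (exitSource i) ++ R ∷ w             ≡⟨ cong (λ z → lefts (exitSource i) ++ z ∷ w) (sym right′) ⟩
    lefts (exitSource i) ++ path (drop i c) (suc e)         ≡⟨ sym (path-leftsThen (exitSource i) (drop i c) (suc e)) ⟩
    path c′ (exitSource i + suc e)            ≡⟨ cong (path c′) (trans (ℕₚ.+-suc (exitSource i) e) (sym (reparamExit-> i e))) ⟩
    path c′ (reparamExit i (suc i + e))       ∎
    where
    c′ = leftsThen (exitSource i) (drop i c)
    w = path (drop i c ∘ suc) e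
    right′ : c (i + 0) ≡ R
    right′ = trans (cong c (ℕₚ.+-identityʳ i)) right

  pump-path-noExit : ∀ c → LeftsBelow c end → ∀ m → pump (path c m) ≡ path (leftsThen hi (drop end c)) (source m)
  pump-path-noExit c below m with ≤⊎> m end
  ... | inj₁ m≤end = begin
    pump (path c m)      ≡⟨ cong pump (path-lefts-≤ c m m≤end below) ⟩
    pump (lefts m)       ≡⟨ pump-lefts m ⟩
    lefts (source m)     ≡⟨ sym (path-lefts-≤ c′ (source m) (source-≤end m m≤end) (leftsThen-below hi (drop end c))) ⟩
    path c′ (source m)   ∎
    where c′ = leftsThen hi (drop end c)
  ... | inj₂ (e , refl) = begin
    pump (path c (suc end + e))              ≡⟨ cong (pump ∘ path c) (sym (ℕₚ.+-suc end e)) ⟩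
    pump (path c (end + suc e))              ≡⟨ cong pump (path-+ c end (suc e)) ⟩
    pump (path c end ++ w)                   ≡⟨ cong (λ z → pump (z ++ w)) (path-lefts c end below) ⟩
    pump (lefts end ++ w)                    ≡⟨ pumpFrom-lefts 0 end w ⟩
    pumpFrom (end + 0) w                     ≡⟨ cong (λ z → pumpFrom z w) (reorder hi extra) ⟩
    pumpFrom (hi + 0 + extra) w              ≡⟨ pumpFrom-beyond 0 w ⟩
    lefts (hi + 0) ++ w                      ≡⟨ cong (λ z → lefts z ++ w) (ℕₚ.+-identityʳ hi) ⟩
    lefts hi ++ w                            ≡⟨ sym (path-leftsThen hi (drop end c) (suc e)) ⟩
    path c′ (hi + suc e)                     ≡⟨ cong (path c′) (sym (trans (cong source (sym (ℕₚ.+-suc end e))) (source-end+ (suc e)))) ⟩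
    path c′ (source (suc end + e))           ∎
    where
    c′ = leftsThen hi (drop end c)
    w = path (drop end c) (suc e)
    reorder : ∀ h l → h + l + 0 ≡ h + 0 + l
    reorder = solve-∀

  pump-path : ∀ c (s : Shape c) m → pump (path c m) ≡ path (image c s) (reparam c s m)
  pump-path c (inj₁ (i , i<end , first)) m with ≤⊎> m i
  ... | inj₁ m≤i        = pump-path-beforeExit c i i<end (proj₂ first) m m≤i
  ... | inj₂ (e , refl) = pump-path-afterExit c i first e
  pump-path c (inj₂ below) m = pump-path-noExit c below m

  reparam-shift : ∀ c (s : Shape c) → ∃[ a ] ∃[ b ] ∀ e → reparam c s (a + e) ≡ b + e
  reparam-shift c (inj₁ (i , _)) = suc i , suc (exitSource i) , reparamExit-> i
  reparam-shift c (inj₂ _)       = end , hi , source-end+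

  reparam-bound : ∀ c (s : Shape c) m → m ≤ end + reparam c s m
  reparam-bound c (inj₁ (i , i<end , _)) m with ≤⊎> m i
  ... | inj₁ m≤i        = ℕₚ.≤-trans (ℕₚ.≤-trans m≤i (ℕₚ.<⇒≤ i<end)) (ℕₚ.m≤m+n end _)
  ... | inj₂ (e , refl) = subst (suc i + e ≤_) (cong (end +_) (sym (reparamExit-> i e)))
                            (ℕₚ.≤-trans (ℕₚ.+-monoˡ-≤ e i<end) (ℕₚ.+-monoʳ-≤ end (ℕₚ.m≤n+m e (suc (exitSource i)))))
  reparam-bound c (inj₂ _) m =
    ℕₚ.≤-trans (source′-bound t m)
      (subst (_≤ end + source m) (ℕₚ.+-comm extra (source m)) (ℕₚ.+-monoˡ-≤ (source m) (ℕₚ.m≤n+m extra hi)))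

indicator : ∀ {A : Set} → Dec A → Fin 2
indicator (yes _) = sucF 0F
indicator (no _)  = 0F

indicator-yes : ∀ {A : Set} (a? : Dec A) → A → indicator a? ≡ sucF 0F
indicator-yes (yes _) _ = refl
indicator-yes (no ¬a) a = ⊥-elim (¬a a)

indicator-no : ∀ {A : Set} (a? : Dec A) → ¬ A → indicator a? ≡ 0F
indicator-no (yes a) ¬a = ⊥-elim (¬a a)
indicator-no (no _)  _  = refl

-- Along a sequence of K > n 2ⁿ positions with states s i and exit states e i, two positions
-- lo < hi agree on the state and on the set of exit states occurring from them on.
module Pigeonhole (n : ℕ) (s e : ℕ → Fin n) where

  K : ℕ
  K = suc (n * 2 ^ n)

  ExitsFrom : ℕ → Fin n → Set
  ExitsFrom i q = ∃[ j ] i ≤ toℕ {K} j × e (toℕ j) ≡ q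

  exitsFrom? : ∀ i q → Dec (ExitsFrom i q)
  exitsFrom? i q = Finₚ.any? (λ j → (i ≤? toℕ j) ×-dec (e (toℕ j) ≟ q))

  exitSet : ℕ → Fin n → Fin 2
  exitSet i q = indicator (exitsFrom? i q)

  code : Fin K → Fin (n * 2 ^ n)
  code x = combine (s (toℕ x)) (funToFin (exitSet (toℕ x)))

  private
    collision = Finₚ.pigeonhole (ℕₚ.n<1+n (n * 2 ^ n)) code
    loF = proj₁ collision
    hiF = proj₁ (proj₂ collision)
    same-code : code loF ≡ code hiF
    same-code = proj₂ (proj₂ (proj₂ collision))

  lo : ℕ
  lo = toℕ loF

  hi : ℕ
  hi = toℕ hiF

  lo<hi : lo < hi
  lo<hi = proj₁ (proj₂ (proj₂ collision))

  hi<K : hi < K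
  hi<K = Finₚ.toℕ<n hiF

  same-state : s lo ≡ s hi
  same-state = proj₁ (Finₚ.combine-injective (s lo) (funToFin (exitSet lo)) (s hi) (funToFin (exitSet hi)) same-code)

  same-exits : ∀ q → exitSet lo q ≡ exitSet hi q
  same-exits q = begin
    exitSet lo q                          ≡⟨ Finₚ.finToFun-funToFin (exitSet lo) q ⟨
    finToFun (funToFin (exitSet lo)) q    ≡⟨ cong (λ z → finToFun z q) same-set ⟩
    finToFun (funToFin (exitSet hi)) q    ≡⟨ Finₚ.finToFun-funToFin (exitSet hi) q ⟩
    exitSet hi q                          ∎
    where
    open ≡-Reasoning
    same-set = proj₂ (Finₚ.combine-injective (s lo) (funToFin (exitSet lo)) (s hi) (funToFin (exitSet hi)) same-code)

  exitTo : ℕ → ℕ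
  exitTo y with exitsFrom? hi (e y)
  ... | yes (j , _ , _) = toℕ j
  ... | no _            = hi

  exitTo-beyond : ∀ y → hi ≤ exitTo y
  exitTo-beyond y with exitsFrom? hi (e y)
  ... | yes (_ , hi≤j , _) = hi≤j
  ... | no _               = ℕₚ.≤-refl

  exitTo-state : ∀ y → lo ≤ y → y < hi → e (exitTo y) ≡ e y
  exitTo-state y lo≤y y<hi with exitsFrom? hi (e y)
  ... | yes (_ , _ , same) = same
  ... | no none = ⊥-elim (0≢1 (trans (sym (indicator-no (exitsFrom? hi (e y)) none))
                                    (trans (sym (same-exits (e y))) (indicator-yes (exitsFrom? lo (e y)) y-exits))))
    where
    y<K = ℕₚ.<-trans y<hi hi<K
    y-exits : ExitsFrom lo (e y)
    y-exits = fromℕ< y<K , subst (lo ≤_) (sym (Finₚ.toℕ-fromℕ< y<K)) lo≤y , cong e (Finₚ.toℕ-fromℕ< y<K)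
    0≢1 : ¬ (0F {1} ≡ sucF 0F)
    0≢1 ()

-- Reparametrised parity conditions

Hit : (ℕ → ℕ) → ℕ → ℕ → Set
Hit μ N j = ∃[ m ] N ≤ m × μ m ≡ j

-- Disjunctive, because whether a branch eventually enters a side cannot be decided at a finite stage.
Recurrent : (ℕ → ℕ) → Set
Recurrent μ = ∀ N j → N ≤ j → Hit μ N j ⊎ ∃[ J ] ∀ j′ → J ≤ j′ → Hit μ N j′

Divergent : (ℕ → ℕ) → Set
Divergent μ = ∀ M → ∃[ N ] ∀ m → N ≤ m → M ≤ μ m

parity-reparam : ∀ π π′ μ → (∀ m → π′ m ≡ π (μ m)) → Recurrent μ → Divergent μ →
                 ParityAccepting π → ParityAccepting π′
parity-reparam π π′ μ π′≡π∘μ recurrent divergent (p , even , often , (M , bounded)) =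
  p , even , often′ , (proj₁ (divergent M) , bounded′)
  where
  hit : ∀ {N j} → π j ≡ p → Hit μ N j → ∃[ m ] m ≥ N × π′ m ≡ p
  hit πj≡p (m , N≤m , μm≡j) = m , N≤m , trans (π′≡π∘μ m) (trans (cong π μm≡j) πj≡p)

  often′ : InfinitelyOften (λ m → π′ m ≡ p)
  often′ N with often N
  ... | j , j≥N , πj≡p with recurrent N j j≥N
  ...   | inj₁ h       = hit πj≡p h
  ...   | inj₂ (J , h) with often J
  ...     | j′ , j′≥J , πj′≡p = hit πj′≡p (h j′ j′≥J)

  bounded′ : ∀ m → m ≥ proj₁ (divergent M) → π′ m ≤ p
  bounded′ m m≥N = subst (_≤ p) (sym (π′≡π∘μ m)) (bounded (μ m) (proj₂ (divergent M) m m≥N))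

-- The witness tree

module Witness (η : Ord) (l K : ℕ) where

  side : Tree
  side = stems K (treeOfRank η)

  T : Tree
  T = stems (suc l) (spine (λ _ → side))

  sideRoot : ℕ → Node
  sideRoot k = lefts (suc l) ++ rights k ++ L ∷ []

  depth : ℕ → ℕ
  depth k = suc l + suc k

  sideRoot-++ : ∀ k u → sideRoot k ++ u ≡ lefts (suc l) ++ rights k ++ L ∷ u
  sideRoot-++ k u = trans (Listₚ.++-assoc (lefts (suc l)) (rights k ++ L ∷ []) u)
                          (cong (lefts (suc l) ++_) (Listₚ.++-assoc (rights k) (L ∷ []) u))

  k<depth : ∀ k → k < depth k
  k<depth k = ℕₚ.≤-trans (ℕₚ.n<1+n k) (ℕₚ.m≤n+m (suc k) (suc l))

  length-sideRoot : ∀ k → length (sideRoot k) ≡ depth k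
  length-sideRoot k =
    trans (Listₚ.length-++ (lefts (suc l)))
          (cong₂ _+_ (length-lefts (suc l))
                     (trans (Listₚ.length-++ (rights k)) (trans (cong (_+ 1) (length-rights k)) (ℕₚ.+-comm k 1))))

  T-sideRoot : ∀ k u → T (sideRoot k ++ u) ≡ side u
  T-sideRoot k u = trans (cong T (sideRoot-++ k u))
                         (trans (stems-at (suc l) _ (rights k ++ L ∷ u)) (spine-at (λ _ → side) k u))

  rank≤-T : RankLeq T ((η +o ω) +o fin l)
  rank≤-T = rank≤-mono (rank≤-stems (suc l) (rank≤-spine _ (λ _ → rank≤-stems K (rank≤-treeOfRank η))))
              (subst (_≤o ((η +o ω) +o fin l)) (sym (+-fin-suc (η +o fin K) l))
                     (+-fin-monoˡ l (≤-cocone (suc K) (≤o-refl (η +o fin (suc K))))))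

  wf-T : WellFounded T
  wf-T = WellFounded′⇒WellFounded T
           (wf-stems (suc l) (wf-spine _ (λ _ → wf-stems K (wf-treeOfRank η))))

  spineIndex : ℕ → Node → Maybe (ℕ × Node)
  spineIndex k []      = nothing
  spineIndex k (L ∷ w) = just (k , w)
  spineIndex k (R ∷ w) = spineIndex (suc k) w

  belowLefts : ℕ → Node → Maybe (ℕ × Node)
  belowLefts zero    w       = spineIndex 0 w
  belowLefts (suc j) (L ∷ w) = belowLefts j w
  belowLefts (suc j) _       = nothing

  -- just (k , u) exactly for the nodes sideRoot k ++ u
  whichSide : Node → Maybe (ℕ × Node)
  whichSide = belowLefts (suc l)

  spineIndex-sound : ∀ k₀ w k u → spineIndex k₀ w ≡ just (k , u) → ∃[ r ] k ≡ k₀ + r × w ≡ rights r ++ L ∷ u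
  spineIndex-sound k₀ (L ∷ w) .k₀ .w refl = 0 , sym (ℕₚ.+-identityʳ k₀) , refl
  spineIndex-sound k₀ (R ∷ w) k u eq with spineIndex-sound (suc k₀) w k u eq
  ... | r , k≡ , refl = suc r , trans k≡ (sym (ℕₚ.+-suc k₀ r)) , refl

  belowLefts-sound : ∀ j w k u → belowLefts j w ≡ just (k , u) → w ≡ lefts j ++ rights k ++ L ∷ u
  belowLefts-sound zero    w       k u eq with spineIndex-sound 0 w k u eq
  ... | r , refl , refl = refl
  belowLefts-sound (suc j) (L ∷ w) k u eq = cong (L ∷_) (belowLefts-sound j w k u eq)

  whichSide-sound : ∀ w k u → whichSide w ≡ just (k , u) → w ≡ sideRoot k ++ u
  whichSide-sound w k u eq = trans (belowLefts-sound (suc l) w k u eq) (sym (sideRoot-++ k u))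

  spineIndex-rights : ∀ k₀ r u → spineIndex k₀ (rights r ++ L ∷ u) ≡ just (k₀ + r , u)
  spineIndex-rights k₀ zero    u = cong (λ z → just (z , u)) (sym (ℕₚ.+-identityʳ k₀))
  spineIndex-rights k₀ (suc r) u =
    trans (spineIndex-rights (suc k₀) r u) (cong (λ z → just (z , u)) (sym (ℕₚ.+-suc k₀ r)))

  belowLefts-lefts : ∀ j v → belowLefts j (lefts j ++ v) ≡ spineIndex 0 v
  belowLefts-lefts zero    v = refl
  belowLefts-lefts (suc j) v = belowLefts-lefts j v

  whichSide-sideRoot : ∀ k u → whichSide (sideRoot k ++ u) ≡ just (k , u)
  whichSide-sideRoot k u = trans (cong whichSide (sideRoot-++ k u))
                                 (trans (belowLefts-lefts (suc l) (rights k ++ L ∷ u)) (spineIndex-rights 0 k u))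

  whichSide-++ : ∀ w k u v → whichSide w ≡ just (k , u) → whichSide (w ++ v) ≡ just (k , u ++ v)
  whichSide-++ w k u v eq =
    trans (cong (λ z → whichSide (z ++ v)) (whichSide-sound w k u eq))
          (trans (cong whichSide (Listₚ.++-assoc (sideRoot k) u v)) (whichSide-sideRoot k (u ++ v)))

  nothing≢just : ∀ {A : Set} {x : A} → ¬ nothing ≡ just x
  nothing≢just ()

  whichSide-init : ∀ w d k u e → whichSide (w ∷ʳ d) ≡ just (k , u ∷ʳ e) → whichSide w ≡ just (k , u)
  whichSide-init w d k u e eq = trans (cong whichSide w≡) (whichSide-sideRoot k u)
    where
    w≡ : w ≡ sideRoot k ++ u
    w≡ = Listₚ.∷ʳ-injectiveˡ w (sideRoot k ++ u)
           (trans (whichSide-sound _ k _ eq) (sym (Listₚ.++-assoc (sideRoot k) u (e ∷ []))))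

  whichSide-entering : ∀ w d k u → whichSide w ≡ nothing → whichSide (w ∷ʳ d) ≡ just (k , u) → u ≡ []
  whichSide-entering w d k u outside inside with initLast u
  ... | []        = refl
  ... | u′ ∷ʳ′ e = ⊥-elim (nothing≢just (trans (sym outside) (whichSide-init w d k u′ e inside)))

  whichSide-lefts : ∀ i → i < suc l → whichSide (lefts i) ≡ nothing
  whichSide-lefts i = go (suc l) i
    where
    go : ∀ j i → i < j → belowLefts j (lefts i) ≡ nothing
    go (suc j) zero    _       = refl
    go (suc j) (suc i) (s≤s p) = go j i p

module Refutation (η : Ord) (l : ℕ) (A : PTA) where
  open PTA A

  K : ℕ
  K = suc (nStates * 2 ^ nStates)

  open Witness η l K public

  module FromRun (run : Accepts A T) where

    ρ : Node → Fin nStates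
    ρ = proj₁ run

    step : ∀ w → δ (ρ w) (T w) (ρ (w ++ L ∷ [])) (ρ (w ++ R ∷ [])) ≡ true
    step = proj₁ (proj₂ (proj₂ run))

    parity : ∀ b → ParityAccepting (λ m → priority (ρ (prefix b m)))
    parity = proj₂ (proj₂ (proj₂ run))

    module Chain (k : ℕ) =
      Pigeonhole nStates (λ i → ρ (sideRoot k ++ lefts i)) (λ i → ρ (sideRoot k ++ lefts i ++ R ∷ []))

    d₀ : ℕ → ℕ
    d₀ k = Chain.hi k ∸ suc (Chain.lo k)

    lo+d≡hi : ∀ k → Chain.lo k + suc (d₀ k) ≡ Chain.hi k
    lo+d≡hi k = trans (ℕₚ.+-suc (Chain.lo k) (d₀ k)) (ℕₚ.m+[n∸m]≡n (Chain.lo<hi k))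

    exitTo-beyond : ∀ k y → Chain.lo k + suc (d₀ k) ≤ Chain.exitTo k y
    exitTo-beyond k y = subst (_≤ Chain.exitTo k y) (sym (lo+d≡hi k)) (Chain.exitTo-beyond k y)

    -- side k is pumped k times, so that the ranks of the sides of x′ grow to η + ω
    module Side (k : ℕ) = Pump (Chain.lo k) (d₀ k) k (Chain.exitTo k) (exitTo-beyond k)

    hi≤K : ∀ k → Side.hi k ≤ K
    hi≤K k = subst (_≤ K) (sym (lo+d≡hi k)) (ℕₚ.<⇒≤ (Chain.hi<K k))

    end-bound : ∀ k M → k ≤ M → Side.end k ≤ K + M * K
    end-bound k M k≤M = ℕₚ.+-mono-≤ (hi≤K k) (ℕₚ.*-mono-≤ k≤M (ℕₚ.≤-trans (ℕₚ.m≤n+m (suc (d₀ k)) (Chain.lo k)) (hi≤K k)))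

    pumpedAt : Node → Maybe (ℕ × Node) → Node
    pumpedAt w nothing        = w
    pumpedAt w (just (k , u)) = sideRoot k ++ Side.pump k u

    pumped : Node → Node
    pumped w = pumpedAt w (whichSide w)

    pumped-outside : ∀ w → whichSide w ≡ nothing → pumped w ≡ w
    pumped-outside w = cong (pumpedAt w)

    pumped-inside : ∀ w k u → whichSide w ≡ just (k , u) → pumped w ≡ sideRoot k ++ Side.pump k u
    pumped-inside w k u = cong (pumpedAt w)

    x′ : Tree
    x′ = T ∘ pumped

    side-snoc : ∀ k u dir → ρ (sideRoot k ++ Side.pump k (u ∷ʳ dir)) ≡ ρ (sideRoot k ++ Side.pump k u ∷ʳ dir)
    side-snoc k u dir = Side.pumpFrom-snoc k (λ v → ρ (sideRoot k ++ v)) loop exits 0 u dir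
      where
      loop : ρ (sideRoot k ++ lefts (Chain.lo k)) ≡ ρ (sideRoot k ++ lefts (Side.hi k))
      loop = trans (Chain.same-state k) (cong (λ z → ρ (sideRoot k ++ lefts z)) (sym (lo+d≡hi k)))
      exits : ∀ y → Chain.lo k ≤ y → y < Side.hi k →
              ρ (sideRoot k ++ lefts (Chain.exitTo k y) ++ R ∷ []) ≡ ρ (sideRoot k ++ lefts y ++ R ∷ [])
      exits y lo≤y y<hi = Chain.exitTo-state k y lo≤y (subst (y <_) (lo+d≡hi k) y<hi)

    pumped-snoc : ∀ w dir → ρ (pumped (w ∷ʳ dir)) ≡ ρ (pumped w ∷ʳ dir)
    pumped-snoc w dir = cases (whichSide w) refl (whichSide (w ∷ʳ dir)) refl
      where
      open ≡-Reasoning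
      cases : ∀ s → whichSide w ≡ s → ∀ s′ → whichSide (w ∷ʳ dir) ≡ s′ → ρ (pumped (w ∷ʳ dir)) ≡ ρ (pumped w ∷ʳ dir)
      cases (just (k , u)) inside _ _ = begin
        ρ (pumped (w ∷ʳ dir))                    ≡⟨ cong ρ (pumped-inside (w ∷ʳ dir) k (u ∷ʳ dir) (whichSide-++ w k u (dir ∷ []) inside)) ⟩
        ρ (sideRoot k ++ Side.pump k (u ∷ʳ dir)) ≡⟨ side-snoc k u dir ⟩
        ρ (sideRoot k ++ Side.pump k u ∷ʳ dir)   ≡⟨ cong ρ (Listₚ.++-assoc (sideRoot k) (Side.pump k u) (dir ∷ [])) ⟨
        ρ ((sideRoot k ++ Side.pump k u) ∷ʳ dir) ≡⟨ cong (λ z → ρ (z ∷ʳ dir)) (pumped-inside w k u inside) ⟨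
        ρ (pumped w ∷ʳ dir)                      ∎
      cases nothing outside nothing outside′ =
        cong ρ (trans (pumped-outside (w ∷ʳ dir) outside′) (cong (_∷ʳ dir) (sym (pumped-outside w outside))))
      cases nothing outside (just (k , u)) inside′ = cong ρ (begin
        pumped (w ∷ʳ dir)                      ≡⟨ pumped-inside (w ∷ʳ dir) k u inside′ ⟩
        sideRoot k ++ Side.pump k u            ≡⟨ cong (λ z → sideRoot k ++ Side.pump k z) u≡[] ⟩
        sideRoot k ++ lefts (Side.source k 0)  ≡⟨ cong (λ z → sideRoot k ++ lefts z) (Side.source-zero k) ⟩
        sideRoot k ++ []                       ≡⟨ cong (sideRoot k ++_) u≡[] ⟨
        sideRoot k ++ u                        ≡⟨ whichSide-sound (w ∷ʳ dir) k u inside′ ⟨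
        w ∷ʳ dir                               ≡⟨ cong (_∷ʳ dir) (pumped-outside w outside) ⟨
        pumped w ∷ʳ dir                        ∎)
        where
        u≡[] = whichSide-entering w dir k u outside inside′

    step′ : ∀ w → δ (ρ (pumped w)) (x′ w) (ρ (pumped (w ++ L ∷ []))) (ρ (pumped (w ++ R ∷ []))) ≡ true
    step′ w = subst₂ (λ ρL ρR → δ (ρ (pumped w)) (x′ w) ρL ρR ≡ true)
                     (sym (pumped-snoc w L)) (sym (pumped-snoc w R)) (step (pumped w))

    rank≥-side : ∀ k → RankGeq (λ u → x′ (lefts (suc l) ++ u)) (η +o fin k)
    rank≥-side k = rank≥-subtree (rights k ++ L ∷ [])
                     (rank≥-cong copy (rank≥-mono k≤ (Side.rank≥-pumped k K (treeOfRank η) η (hi≤K k) (rank≥-treeOfRank η))))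
      where
      copy : ∀ u → side (Side.pump k u) ≡ x′ (lefts (suc l) ++ (rights k ++ L ∷ []) ++ u)
      copy u = sym (trans (cong x′ (sym (Listₚ.++-assoc (lefts (suc l)) (rights k ++ L ∷ []) u)))
                          (trans (cong T (pumped-inside (sideRoot k ++ u) k u (whichSide-sideRoot k u))) (T-sideRoot k (Side.pump k u))))
      k≤ : (η +o fin k) ≤o (η +o fin (K + Side.extra k))
      k≤ = +-fin-monoʳ η (ℕₚ.≤-trans (ℕₚ.m≤m*n k (suc (d₀ k))) (ℕₚ.m≤n+m (k * suc (d₀ k)) K))

    rank≥-x′ : RankGeq x′ (osuc ((η +o ω) +o fin l))
    rank≥-x′ = rank≥-lefts (suc l) top (rank≥-lim (λ k → η +o fin k) rank≥-side)
      where
      top : ∀ i → i < suc l → x′ (lefts i) ≡ true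
      top i i<1+l = trans (cong T (pumped-outside (lefts i) (whichSide-lefts i i<1+l))) (stems-lefts (suc l) _ i i<1+l)

    -- A branch b of x′ is followed, through `pumped`, by a branch b′ of T, at positions μ m.
    module OnBranch (b : Branch) where

      c : ℕ → Branch
      c k = drop (depth k) b

      shapeOf : ∀ k → Side.Shape k (c k)
      shapeOf k = Side.shape k (c k)

      c′ : ℕ → Branch
      c′ k = Side.image k (c k) (shapeOf k)

      μ′ : ℕ → ℕ → ℕ
      μ′ k = Side.reparam k (c k) (shapeOf k)

      open ≡-Reasoning

      dirAt : ℕ → Maybe (ℕ × Node) → Dir
      dirAt j nothing        = b j
      dirAt j (just (k , u)) = c′ k (length u)

      b′ : Branch
      b′ j = dirAt j (whichSide (path b j))

      posAt : ℕ → Maybe (ℕ × Node) → ℕ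
      posAt m nothing        = m
      posAt m (just (k , u)) = depth k + μ′ k (length u)

      μ : ℕ → ℕ
      μ m = posAt m (whichSide (path b m))

      entered : ∀ m k u → whichSide (path b m) ≡ just (k , u) →
                path b (depth k) ≡ sideRoot k × m ≡ depth k + length u × u ≡ path (c k) (length u)
      entered m k u eq = proj₁ split , m≡ , sym (proj₂ split)
        where
        path≡ : path b m ≡ sideRoot k ++ u
        path≡ = whichSide-sound (path b m) k u eq
        m≡ : m ≡ depth k + length u
        m≡ = trans (sym (length-path b m))
               (trans (cong length path≡) (trans (Listₚ.length-++ (sideRoot k)) (cong (_+ length u) (length-sideRoot k))))
        split = ++-injective (path b (depth k)) (path (c k) (length u)) (sideRoot k) u
                  (trans (sym (path-+ b (depth k) (length u))) (trans (cong (path b) (sym m≡)) path≡))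
                  (trans (length-path b (depth k)) (sym (length-sideRoot k)))

      inside : ∀ k → path b (depth k) ≡ sideRoot k → ∀ r → whichSide (path b (depth k + r)) ≡ just (k , path (c k) r)
      inside k root r = trans (cong whichSide (trans (path-+ b (depth k) r) (cong (_++ path (c k) r) root)))
                              (whichSide-sideRoot k (path (c k) r))

      stays : ∀ {j m k u} → j ≤ m → whichSide (path b j) ≡ just (k , u) →
              whichSide (path b m) ≡ just (k , u ++ path (drop j b) (m ∸ j))
      stays {j} {m} {k} {u} j≤m eq =
        trans (cong whichSide (trans (cong (path b) (sym (ℕₚ.m+[n∸m]≡n j≤m))) (path-+ b j (m ∸ j))))
              (whichSide-++ (path b j) k u _ eq)

      b′-outside : ∀ m → whichSide (path b m) ≡ nothing → ∀ j → j < m → b′ j ≡ b j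
      b′-outside m outside j j<m = cases (whichSide (path b j)) refl
        where
        cases : ∀ s → whichSide (path b j) ≡ s → b′ j ≡ b j
        cases nothing  eq = cong (dirAt j) eq
        cases (just _) eq = ⊥-elim (nothing≢just (trans (sym outside) (stays (ℕₚ.<⇒≤ j<m) eq)))

      b′-before : ∀ k → path b (depth k) ≡ sideRoot k → ∀ j → j < depth k → b′ j ≡ b j
      b′-before k root j j<depth = cases (whichSide (path b j)) refl
        where
        cases : ∀ s → whichSide (path b j) ≡ s → b′ j ≡ b j
        cases nothing         eq = cong (dirAt j) eq
        cases (just (k′ , u)) eq = ⊥-elim (ℕₚ.<⇒≱ j<depth depth≤j)
          where
          same : just (k′ , _) ≡ just (k , [])
          same = trans (sym (stays (ℕₚ.<⇒≤ j<depth) eq))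
                       (trans (cong whichSide (trans root (sym (Listₚ.++-identityʳ (sideRoot k))))) (whichSide-sideRoot k []))
          depth≤j : depth k ≤ j
          depth≤j = subst (λ z → depth z ≤ j) (cong proj₁ (Maybeₚ.just-injective same))
                      (subst (depth k′ ≤_) (sym (proj₁ (proj₂ (entered j k′ u eq)))) (ℕₚ.m≤m+n (depth k′) (length u)))

      b′-inside : ∀ k → path b (depth k) ≡ sideRoot k → ∀ x → b′ (depth k + x) ≡ c′ k x
      b′-inside k root x = trans (cong (dirAt (depth k + x)) (inside k root x)) (cong (c′ k) (length-path (c k) x))

      b′-root : ∀ k → path b (depth k) ≡ sideRoot k → path b′ (depth k) ≡ sideRoot k
      b′-root k root = trans (path-restrict (depth k) (b′-before k root)) root

      μ-outside : ∀ m → whichSide (path b m) ≡ nothing → μ m ≡ m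
      μ-outside m = cong (posAt m)

      μ-inside : ∀ m k u → whichSide (path b m) ≡ just (k , u) → μ m ≡ depth k + μ′ k (length u)
      μ-inside m k u = cong (posAt m)

      pumped-path : ∀ m → pumped (path b m) ≡ path b′ (μ m)
      pumped-path m = cases (whichSide (path b m)) refl
        where
        cases : ∀ s → whichSide (path b m) ≡ s → pumped (path b m) ≡ path b′ (μ m)
        cases nothing eq = begin
          pumped (path b m) ≡⟨ pumped-outside (path b m) eq ⟩
          path b m          ≡⟨ path-restrict m (λ j j<m → sym (b′-outside m eq j j<m)) ⟩
          path b′ m         ≡⟨ cong (path b′) (μ-outside m eq) ⟨
          path b′ (μ m)     ∎
        cases (just (k , u)) eq = let root , _ , u≡ = entered m k u eq ; r = length u in begin
          pumped (path b m)                                      ≡⟨ pumped-inside (path b m) k u eq ⟩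
          sideRoot k ++ Side.pump k u                            ≡⟨ cong (λ z → sideRoot k ++ Side.pump k z) u≡ ⟩
          sideRoot k ++ Side.pump k (path (c k) r)               ≡⟨ cong (sideRoot k ++_) (Side.pump-path k (c k) (shapeOf k) r) ⟩
          sideRoot k ++ path (c′ k) (μ′ k r)                     ≡⟨ cong₂ _++_ (sym (b′-root k root)) (path-restrict (μ′ k r) (λ x _ → sym (b′-inside k root x))) ⟩
          path b′ (depth k) ++ path (drop (depth k) b′) (μ′ k r) ≡⟨ path-+ b′ (depth k) (μ′ k r) ⟨
          path b′ (depth k + μ′ k r)                             ≡⟨ cong (path b′) (μ-inside m k u eq) ⟨
          path b′ (μ m)                                          ∎

      μ-recurrent : Recurrent μ
      μ-recurrent N j N≤j = cases (whichSide (path b j)) refl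
        where
        cases : ∀ s → whichSide (path b j) ≡ s → Hit μ N j ⊎ ∃[ J ] ∀ j′ → J ≤ j′ → Hit μ N j′
        cases nothing        eq = inj₁ (j , N≤j , μ-outside j eq)
        cases (just (k , u)) eq = inj₂ (depth k + a′ + N , hit)
          where
          root = proj₁ (entered j k u eq)
          shift = Side.reparam-shift k (c k) (shapeOf k)
          a = proj₁ shift
          a′ = proj₁ (proj₂ shift)
          hit : ∀ j′ → depth k + a′ + N ≤ j′ → Hit μ N j′
          hit j′ bound = m , N≤m , μm≡j′
            where
            e = j′ ∸ (depth k + a′)
            m = depth k + (a + e)
            N≤e : N ≤ e
            N≤e = subst (_≤ e) (ℕₚ.m+n∸m≡n (depth k + a′) N) (ℕₚ.∸-monoˡ-≤ (depth k + a′) bound)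
            N≤m : N ≤ m
            N≤m = ℕₚ.≤-trans N≤e (ℕₚ.≤-trans (ℕₚ.m≤n+m e a) (ℕₚ.m≤n+m (a + e) (depth k)))
            μm≡j′ : μ m ≡ j′
            μm≡j′ = begin
              μ m                           ≡⟨ μ-inside m k _ (inside k root (a + e)) ⟩
              depth k + μ′ k (length (path (c k) (a + e))) ≡⟨ cong (λ z → depth k + μ′ k z) (length-path (c k) (a + e)) ⟩
              depth k + μ′ k (a + e)        ≡⟨ cong (depth k +_) (proj₂ (proj₂ shift) e) ⟩
              depth k + (a′ + e)            ≡⟨ ℕₚ.+-assoc (depth k) a′ e ⟨
              depth k + a′ + e              ≡⟨ ℕₚ.m+[n∸m]≡n (ℕₚ.≤-trans (ℕₚ.m≤m+n (depth k + a′) N) bound) ⟩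
              j′                            ∎

      -- Sides of index k < M have their pumped part within K + M K levels; deeper sides start below M.
      μ-divergent : Divergent μ
      μ-divergent M = M + X , λ m bound → cases m bound (whichSide (path b m)) refl
        where
        X = K + M * K
        cases : ∀ m → M + X ≤ m → ∀ s → whichSide (path b m) ≡ s → M ≤ μ m
        cases m bound nothing eq = subst (M ≤_) (sym (μ-outside m eq)) (ℕₚ.≤-trans (ℕₚ.m≤m+n M X) bound)
        cases m bound (just (k , u)) eq = subst (M ≤_) (sym (μ-inside m k u eq)) (reaches (M ≤? k))
          where
          r = length u
          reaches : Dec (M ≤ k) → M ≤ depth k + μ′ k r
          reaches (yes M≤k) = ℕₚ.≤-trans M≤k (ℕₚ.≤-trans (ℕₚ.<⇒≤ (k<depth k)) (ℕₚ.m≤m+n (depth k) (μ′ k r)))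
          reaches (no M≰k)  = +-cancel-slack M X (depth k) r (Side.end k) (μ′ k r)
                                (subst (M + X ≤_) (proj₁ (proj₂ (entered m k u eq))) bound)
                                (Side.reparam-bound k (c k) (shapeOf k) r) (end-bound k M (ℕₚ.<⇒≤ (ℕₚ.≰⇒> M≰k)))

      parity′ : ParityAccepting (λ m → priority (ρ (pumped (prefix b m))))
      parity′ = parity-reparam _ _ μ same-states μ-recurrent μ-divergent (parity b′)
        where
        same-states : ∀ m → priority (ρ (pumped (prefix b m))) ≡ priority (ρ (prefix b′ (μ m)))
        same-states m = cong (priority ∘ ρ)
          (trans (cong pumped (prefix≡path b m)) (trans (pumped-path m) (sym (prefix≡path b′ (μ m)))))

    accepts-x′ : Accepts A x′
    accepts-x′ = ρ ∘ pumped , proj₁ (proj₂ run) , step′ , OnBranch.parity′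

lemma13 : (η : Ord) (l : ℕ) → ¬ Regular (L≤ ((η +o ω) +o fin l))
lemma13 η l (A , recognises) = ¬rank≤-of-rank≥-suc rank≥-x′ (proj₂ (proj₂ (recognises x′) accepts-x′))
  where
  open Refutation η l A
  open FromRun (proj₁ (recognises T) (wf-T , rank≤-T))
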